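{- For every odd positive integer $m$, the set of nonnegative integers $s$ such that $m\nmid\binom{2^{s+1}}{2^s}$ has asymptotic density $0$; that is, $\lim_{a\to\infty}\frac{1}{a}\#\{0\le s<a : m\nmid\binom{2^{s+1}}{2^s}\}=0$. -}

module Defs where

open import Data.Nat using (ℕ; zero; suc; _+_; _^_)
open import Data.Nat.Divisibility using (_∣_; _∣?_)
open import Data.Nat.Combinatorics using (_C_)
open import Relation.Nullary using (yes; no)

centralBinom2 : ℕ → ℕ
centralBinom2 s = (2 ^ suc s) C (2 ^ s)

badCount : ℕ → ℕ → ℕ
badCount m zero = 0
badCount m (suc a) with m ∣? centralBinom2 a
... | yes _ = badCount m a
... | no  _ = suc (badCount m a)

{-# OPTIONS --safe #-}

-- Fix an odd prime p = 2h + 1 and write n = a ^ s in base p (for the theorem, a = 2).  By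
-- Legendre's formula every position at which n has a digit larger than h produces a carry in
-- n + n, hence a factor p of C(2n, n).  If a ^ T = 1 + p ^ (t + 1) · u with p ∤ u, lifting the
-- exponent gives a ^ (T · p ^ j) = 1 + p ^ (t + 1 + j) · u_j with p ∤ u_j.  So replacing s by
-- s + c · T · p ^ j leaves the digits of a ^ s below position t + 1 + j unchanged and moves the
-- digit at that position along an arithmetic progression modulo p, which meets {0, …, h} for at
-- most h + 1 of the p values of c.  Hence the s for which the digits of a ^ s in a window of M
-- consecutive positions are all ≤ h have density at most ((h + 1) / p) ^ M, while
-- p ^ e ∤ C(2 a ^ s, a ^ s) forces this in one of e disjoint windows.  Finally, for odd m,
-- m ∤ C(2n, n) forces q ^ j ∤ C(2n, n) for one of the finitely many odd prime powers q ^ j ∣ m.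

module Submission where

open import Defs
open import Data.Nat
open import Data.Nat.Properties
open import Data.Nat.Divisibility
open import Data.Nat.DivMod
open import Data.Nat.Primality using (Prime; euclidsLemma; prime⇒nonZero; prime⇒nonTrivial; prime⇒irreducible; prime?; prime[2]; ¬prime[1])
open import Data.Nat.Primality.Factorisation using (factorise; PrimeFactorisation)
open import Data.Nat.ListAction using (product)
open import Data.List.Base using (_∷_)
open import Data.List.Relation.Unary.All using (All; []; _∷_)
open import Data.Nat.Combinatorics using (_C_; nCk≡n!/k![n-k]!; k![n∸k]!∣n!)
open import Data.Product using (∃-syntax; _,_; _×_; proj₁; proj₂)
open import Data.Sum using (inj₁; inj₂; [_,_])
open import Data.Empty using (⊥-elim)
open import Function using (id)
open import Data.Fin using (toℕ; fromℕ<)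
open import Data.Fin.Properties using (pigeonhole; toℕ-fromℕ<)
open import Induction.WellFounded using (Acc; acc)
open import Data.Nat.Induction using (<-wellFounded)
open import Level using (Level)
open import Relation.Nullary using (¬_; Dec; yes; no; ¬?; _×-dec_; _→-dec_)
open import Relation.Binary.PropositionalEquality hiding ([_])
open import Relation.Binary.Structures using (IsPreorder)
open import Relation.Binary.Bundles using (Preorder)
import Relation.Binary.Reasoning.Preorder as PreorderReasoning
open import Data.Nat.Tactic.RingSolver using (solve-∀)

private
  variable
    ℓ ℓ′ : Level
    P : Set ℓ
    Q : Set ℓ′

𝟙 : Dec P → ℕ
𝟙 (yes _) = 1
𝟙 (no  _) = 0

𝟙≤1 : (P? : Dec P) → 𝟙 P? ≤ 1
𝟙≤1 (yes _) = ≤-refl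
𝟙≤1 (no  _) = z≤n

𝟙-yes : (P? : Dec P) → P → 𝟙 P? ≡ 1
𝟙-yes (yes _) _ = refl
𝟙-yes (no ¬p) p = ⊥-elim (¬p p)

𝟙-no : (P? : Dec P) → ¬ P → 𝟙 P? ≡ 0
𝟙-no (yes p) ¬p = ⊥-elim (¬p p)
𝟙-no (no  _) _  = refl

𝟙≡0⇒¬ : (P? : Dec P) → 𝟙 P? ≡ 0 → ¬ P
𝟙≡0⇒¬ (no ¬p) _ = ¬p

𝟙¬≡0⇒ : (P? : Dec P) → 𝟙 (¬? P?) ≡ 0 → P
𝟙¬≡0⇒ (yes p) _ = p

𝟙-mono : (P? : Dec P) (Q? : Dec Q) → (P → Q) → 𝟙 P? ≤ 𝟙 Q?
𝟙-mono (yes _) (yes _) _   = ≤-refl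
𝟙-mono (yes p) (no ¬q) p⇒q = ⊥-elim (¬q (p⇒q p))
𝟙-mono (no  _) _       _   = z≤n

𝟙-¬-≤ : (P? : Dec P) (x : ℕ) → (x ≡ 0 → P) → 𝟙 (¬? P?) ≤ x
𝟙-¬-≤ P? zero    x≡0⇒p = ≤-reflexive (𝟙-no (¬? P?) (λ ¬p → ¬p (x≡0⇒p refl)))
𝟙-¬-≤ P? (suc x) _     = ≤-trans (𝟙≤1 (¬? P?)) (s≤s z≤n)

^-monoʳ-∣ : ∀ m {a b} → a ≤ b → m ^ a ∣ m ^ b
^-monoʳ-∣ m {a} {b} a≤b = divides (m ^ (b ∸ a)) (begin
  m ^ b               ≡⟨ cong (m ^_) (m+[n∸m]≡n a≤b) ⟨
  m ^ (a + (b ∸ a))   ≡⟨ ^-distribˡ-+-* m a (b ∸ a) ⟩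
  m ^ a * m ^ (b ∸ a) ≡⟨ *-comm (m ^ a) _ ⟩
  m ^ (b ∸ a) * m ^ a ∎)
  where open ≡-Reasoning

∤-*+ : ∀ {d} q {r} → 0 < r → r < d → ¬ d ∣ q * d + r
∤-*+ {d} q {suc r} _ r<d d∣ = <⇒≱ r<d (∣⇒≤ (∣m+n∣m⇒∣n d∣ (n∣m*n q)))

m*n≤o⇒m≤o/n : ∀ {m o} n .{{_ : NonZero n}} → m * n ≤ o → m ≤ o / n
m*n≤o⇒m≤o/n {m} {o} n mn≤o = subst (_≤ o / n) (m*n/n≡m m n) (/-monoˡ-≤ n mn≤o)

m<[1+m/n]*n : ∀ m n .{{_ : NonZero n}} → m < suc (m / n) * n
m<[1+m/n]*n m n = begin-strict
  m                  ≡⟨ m≡m%n+[m/n]*n m n ⟩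
  m % n + m / n * n  <⟨ +-monoˡ-< (m / n * n) (m%n<n m n) ⟩
  n + m / n * n      ∎
  where open ≤-Reasoning

[1+m/n]*n≤m+n : ∀ m n .{{_ : NonZero n}} → suc (m / n) * n ≤ m + n
[1+m/n]*n≤m+n m n = ≤-trans (+-monoʳ-≤ n (m/n*n≤m m n)) (≤-reflexive (+-comm n m))

%≡%-+⇒∣ : ∀ x z {n} .{{_ : NonZero n}} → x % n ≡ (x + z) % n → n ∣ z
%≡%-+⇒∣ x z {n} eq = ∣m+n∣m⇒∣n (divides ((x + z) / n) (+-cancelˡ-≡ (x % n) _ _ (begin
  x % n + (x / n * n + z)       ≡⟨ +-assoc (x % n) _ z ⟨
  x % n + x / n * n + z         ≡⟨ cong (_+ z) (m≡m%n+[m/n]*n x n) ⟨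
  x + z                         ≡⟨ m≡m%n+[m/n]*n (x + z) n ⟩
  (x + z) % n + (x + z) / n * n ≡⟨ cong (_+ (x + z) / n * n) eq ⟨
  x % n + (x + z) / n * n       ∎))) (n∣m*n (x / n))
  where open ≡-Reasoning

n<m^n : ∀ {m} → 1 < m → ∀ n → n < m ^ n
n<m^n 1<m zero    = z<s
n<m^n {m} 1<m (suc n) = begin-strict
  suc n             ≤⟨ n<m^n 1<m n ⟩
  m ^ n             <⟨ m<m+n (m ^ n) 0<m^n ⟩
  m ^ n + m ^ n     ≡⟨ cong (m ^ n +_) (+-identityʳ (m ^ n)) ⟨
  2 * m ^ n         ≤⟨ *-monoˡ-≤ (m ^ n) 1<m ⟩
  m * m ^ n         ∎
  where
  open ≤-Reasoning
  0<m^n : 0 < m ^ n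
  0<m^n = <-≤-trans z<s (n<m^n 1<m n)

odd⇒≡1+2* : ∀ {n} → ¬ 2 ∣ n → ∃[ h ] n ≡ suc (2 * h)
odd⇒≡1+2* {n} 2∤n with n % 2 | m%n<n n 2 | m≡m%n+[m/n]*n n 2
... | zero        | _            | n≡ = ⊥-elim (2∤n (divides (n / 2) n≡))
... | suc zero    | _            | n≡ = n / 2 , trans n≡ (cong suc (*-comm (n / 2) 2))
... | suc (suc _) | s<s (s<s ()) | _

factor-out-powers : ∀ {p} → 1 < p → ∀ {w} → 0 < w → ∃[ t ] ∃[ u ] (¬ p ∣ u × w ≡ p ^ t * u)
factor-out-powers {p} 1<p {w} = split w (<-wellFounded w)
  where
  split : ∀ w → Acc _<_ w → 0 < w → ∃[ t ] ∃[ u ] (¬ p ∣ u × w ≡ p ^ t * u)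
  split w (acc rec) w>0 with p ∣? w
  ... | no  p∤w = 0 , w , p∤w , sym (+-identityʳ w)
  ... | yes (divides q refl) with split q (rec (m<m*n q p {{q≢0}} 1<p)) (>-nonZero⁻¹ q {{q≢0}})
    where q≢0 = m*n≢0⇒m≢0 q {{>-nonZero w>0}}
  ... | t , u , p∤u , refl = suc t , u , p∤u , regroup (p ^ t) u p
    where
    regroup : ∀ P u p → P * u * p ≡ p * P * u
    regroup = solve-∀

powers-collide-mod : ∀ a n .{{_ : NonZero n}} → ∃[ x ] ∃[ d ] (a ^ x % n ≡ a ^ (x + suc d) % n)
powers-collide-mod a n with pigeonhole (n<1+n n) (λ i → fromℕ< (m%n<n (a ^ toℕ i) n))
... | i , j , i<j , fi≡fj with m≤n⇒∃[o]m+o≡n i<j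
... | d , 1+i+d≡j = toℕ i , d , (begin
  a ^ toℕ i % n                      ≡⟨ toℕ-fromℕ< _ ⟨
  toℕ (fromℕ< (m%n<n (a ^ toℕ i) n)) ≡⟨ cong toℕ fi≡fj ⟩
  toℕ (fromℕ< (m%n<n (a ^ toℕ j) n)) ≡⟨ toℕ-fromℕ< _ ⟩
  a ^ toℕ j % n                      ≡⟨ cong (λ k → a ^ k % n) (trans (sym 1+i+d≡j) (sym (+-suc (toℕ i) d))) ⟩
  a ^ (toℕ i + suc d) % n            ∎)
  where open ≡-Reasoning

bernoulli : ∀ H M → H ^ M * (H + M) ≤ suc H ^ M * H
bernoulli H zero    = ≤-reflexive (cong (_+ 0) (+-identityʳ H))
bernoulli H (suc M) = begin
  H ^ suc M * (H + suc M)                 ≤⟨ m≤m+n _ (H ^ M * M) ⟩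
  H ^ suc M * (H + suc M) + H ^ M * M     ≡⟨ regroup H M (H ^ M) ⟩
  suc H * (H ^ M * (H + M))               ≤⟨ *-monoʳ-≤ (suc H) (bernoulli H M) ⟩
  suc H * (suc H ^ M * H)                 ≡⟨ *-assoc (suc H) (suc H ^ M) H ⟨
  suc H ^ suc M * H                       ∎
  where
  open ≤-Reasoning
  regroup : ∀ H M X → H * X * (H + suc M) + X * M ≡ suc H * (X * (H + M))
  regroup = solve-∀

-- M = (H + 1) · c works, by Bernoulli's inequality.
^-dominates : ∀ {H P} → suc H < P → ∀ c → ∃[ M ] (c * suc H ^ M ≤ P ^ M)
^-dominates {H} {P} 1+H<P c = M , (begin
  c * suc H ^ M         ≤⟨ *-monoˡ-≤ (suc H ^ M) (n≤1+n c) ⟩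
  suc c * suc H ^ M     ≡⟨ *-comm (suc c) _ ⟩
  suc H ^ M * suc c     ≤⟨ *-cancelʳ-≤ _ _ (suc H) (≤-trans (≤-reflexive (regroup (suc H ^ M) (suc H) c))
                                                              (bernoulli (suc H) M)) ⟩
  suc (suc H) ^ M       ≤⟨ ^-monoˡ-≤ M 1+H<P ⟩
  P ^ M                 ∎)
  where
  open ≤-Reasoning
  M = suc H * c
  regroup : ∀ X H c → X * suc c * H ≡ X * (H + H * c)
  regroup = solve-∀

-- Binomial expansion and lifting the exponent

triangular : ℕ → ℕ
triangular zero    = 0
triangular (suc n) = triangular n + n

triangular-odd : ∀ h → triangular (suc (2 * h)) ≡ suc (2 * h) * h
triangular-odd zero    = refl
triangular-odd (suc h) = begin
  triangular (suc (2 * suc h))                                ≡⟨ cong (λ n → triangular (suc n)) (2[1+h]≡ h) ⟩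
  triangular (suc (2 * h)) + suc (2 * h) + suc (suc (2 * h)) ≡⟨ cong (λ n → n + suc (2 * h) + suc (suc (2 * h))) (triangular-odd h) ⟩
  suc (2 * h) * h + suc (2 * h) + suc (suc (2 * h))          ≡⟨ collect h ⟩
  suc (2 * suc h) * suc h                                    ∎
  where
  open ≡-Reasoning
  2[1+h]≡ : ∀ h → 2 * suc h ≡ suc (suc (2 * h))
  2[1+h]≡ = solve-∀
  collect : ∀ h → suc (2 * h) * h + suc (2 * h) + suc (suc (2 * h)) ≡ suc (2 * suc h) * suc h
  collect = solve-∀

binomial-expansion₃ : ∀ x n → ∃[ z ] ((1 + x) ^ n ≡ 1 + n * x + triangular n * x * x + x * x * x * z)
binomial-expansion₃ x zero    = 0 , expand x
  where
  expand : ∀ x → 1 ≡ 1 + 0 * x + 0 * x * x + x * x * x * 0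
  expand = solve-∀
binomial-expansion₃ x (suc n) with binomial-expansion₃ x n
... | z , eq = z + triangular n + x * z , trans (cong ((1 + x) *_) eq) (expand x n (triangular n) z)
  where
  expand : ∀ x n t z → (1 + x) * (1 + n * x + t * x * x + x * x * x * z) ≡
                       1 + suc n * x + (t + n) * x * x + x * x * x * (z + t + x * z)
  expand = solve-∀

binomial-expansion₂ : ∀ x n → ∃[ z ] ((1 + x) ^ n ≡ 1 + n * x + x * x * z)
binomial-expansion₂ x n with binomial-expansion₃ x n
... | z , eq = triangular n + x * z , trans eq (regroup (n * x) (triangular n) x z)
  where
  regroup : ∀ nx t x z → 1 + nx + t * x * x + x * x * x * z ≡ 1 + nx + x * x * (t + x * z)
  regroup = solve-∀

lift-exponent : ∀ {p} h → p ≡ suc (2 * h) → ∀ k {w} → ¬ p ∣ w →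
                ∃[ w′ ] (¬ p ∣ w′ × (1 + p ^ suc k * w) ^ p ≡ 1 + p ^ suc (suc k) * w′)
lift-exponent {p} h p≡1+2h k {w} p∤w with binomial-expansion₃ (p ^ suc k * w) p
... | z , eq = w + p * r , p∤w+pr , trans eq (trans (cong (λ s → 1 + p * x + s * x * x + x * x * x * z) triangular-p)
                                                   (regroup p h (p ^ k) w z))
  where
  x = p ^ suc k * w
  r = h * p ^ k * w * w + p ^ k * p ^ k * w * w * w * z
  triangular-p : triangular p ≡ p * h
  triangular-p = subst (λ q → triangular q ≡ q * h) (sym p≡1+2h) (triangular-odd h)
  p∤w+pr : ¬ p ∣ w + p * r
  p∤w+pr p∣ = p∤w (∣m+n∣m⇒∣n (subst (p ∣_) (+-comm w (p * r)) p∣) (m∣m*n r))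
  regroup : ∀ p h P w z → let x = p * P * w in
            1 + p * x + p * h * x * x + x * x * x * z ≡ 1 + p * (p * P) * (w + p * (h * P * w * w + P * P * w * w * w * z))
  regroup = solve-∀

∑< : ℕ → (ℕ → ℕ) → ℕ
∑< zero    f = 0
∑< (suc n) f = ∑< n f + f n

syntax ∑< n (λ i → e) = ∑[ i < n ] e

∑-cong : ∀ n {f g : ℕ → ℕ} → (∀ i → i < n → f i ≡ g i) → ∑< n f ≡ ∑< n g
∑-cong zero    eq = refl
∑-cong (suc n) eq = cong₂ _+_ (∑-cong n (λ i i<n → eq i (m<n⇒m<1+n i<n))) (eq n ≤-refl)

∑-mono-≤ : ∀ n {f g : ℕ → ℕ} → (∀ i → i < n → f i ≤ g i) → ∑< n f ≤ ∑< n g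
∑-mono-≤ zero    le = z≤n
∑-mono-≤ (suc n) le = +-mono-≤ (∑-mono-≤ n (λ i i<n → le i (m<n⇒m<1+n i<n))) (le n ≤-refl)

∑-distrib-+ : ∀ n (f g : ℕ → ℕ) → ∑[ i < n ] (f i + g i) ≡ ∑< n f + ∑< n g
∑-distrib-+ zero    f g = refl
∑-distrib-+ (suc n) f g = begin
  ∑[ i < n ] (f i + g i) + (f n + g n) ≡⟨ cong (_+ (f n + g n)) (∑-distrib-+ n f g) ⟩
  ∑< n f + ∑< n g + (f n + g n)        ≡⟨ +-interchange (∑< n f) _ _ _ ⟩
  ∑< n f + f n + (∑< n g + g n)        ∎
  where
  open ≡-Reasoning
  +-interchange : ∀ a b c d → a + b + (c + d) ≡ a + c + (b + d)
  +-interchange = solve-∀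

*-distribˡ-∑ : ∀ n c (f : ℕ → ℕ) → c * ∑< n f ≡ ∑[ i < n ] (c * f i)
*-distribˡ-∑ zero    c f = *-zeroʳ c
*-distribˡ-∑ (suc n) c f =
  trans (*-distribˡ-+ c (∑< n f) (f n)) (cong (_+ c * f n) (*-distribˡ-∑ n c f))

*-distribʳ-∑ : ∀ n c (f : ℕ → ℕ) → ∑< n f * c ≡ ∑[ i < n ] (f i * c)
*-distribʳ-∑ n c f = trans (*-comm (∑< n f) c)
  (trans (*-distribˡ-∑ n c f) (∑-cong n (λ i _ → *-comm c (f i))))

∑-const : ∀ n c → ∑[ i < n ] c ≡ n * c
∑-const zero    c = refl
∑-const (suc n) c = trans (cong (_+ c) (∑-const n c)) (+-comm (n * c) c)

∑-+ : ∀ n m (f : ℕ → ℕ) → ∑< (n + m) f ≡ ∑< n f + ∑[ i < m ] f (n + i)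
∑-+ n zero    f = trans (cong (λ k → ∑< k f) (+-identityʳ n)) (sym (+-identityʳ _))
∑-+ n (suc m) f = begin
  ∑< (n + suc m) f                                 ≡⟨ cong (λ k → ∑< k f) (+-suc n m) ⟩
  ∑< (n + m) f + f (n + m)                         ≡⟨ cong (_+ f (n + m)) (∑-+ n m f) ⟩
  ∑< n f + ∑[ i < m ] f (n + i) + f (n + m)        ≡⟨ +-assoc (∑< n f) _ _ ⟩
  ∑< n f + (∑[ i < m ] f (n + i) + f (n + m))      ∎
  where open ≡-Reasoning

∑-* : ∀ a b (f : ℕ → ℕ) → ∑< (a * b) f ≡ ∑[ c < a ] ∑[ i < b ] f (c * b + i)
∑-* zero    b f = refl
∑-* (suc a) b f = begin
  ∑< (b + a * b) f                                  ≡⟨ cong (λ k → ∑< k f) (+-comm b (a * b)) ⟩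
  ∑< (a * b + b) f                                  ≡⟨ ∑-+ (a * b) b f ⟩
  ∑< (a * b) f + ∑[ i < b ] f (a * b + i)           ≡⟨ cong (_+ ∑[ i < b ] f (a * b + i)) (∑-* a b f) ⟩
  ∑[ c < a ] ∑[ i < b ] f (c * b + i) + ∑[ i < b ] f (a * b + i) ∎
  where open ≡-Reasoning

∑-comm : ∀ n m (g : ℕ → ℕ → ℕ) → ∑[ i < n ] ∑[ j < m ] g i j ≡ ∑[ j < m ] ∑[ i < n ] g i j
∑-comm zero    m g = sym (trans (∑-const m 0) (*-zeroʳ m))
∑-comm (suc n) m g = trans (cong (_+ ∑[ j < m ] g n j) (∑-comm n m g))
                           (sym (∑-distrib-+ m (λ j → ∑[ i < n ] g i j) (λ j → g n j)))

∑-monoˡ-≤ : ∀ (f : ℕ → ℕ) {n m} → n ≤ m → ∑< n f ≤ ∑< m f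
∑-monoˡ-≤ f {n} {m} n≤m = begin
  ∑< n f                            ≤⟨ m≤m+n _ _ ⟩
  ∑< n f + ∑[ i < m ∸ n ] f (n + i) ≡⟨ sym (∑-+ n (m ∸ n) f) ⟩
  ∑< (n + (m ∸ n)) f                ≡⟨ cong (λ k → ∑< k f) (m+[n∸m]≡n n≤m) ⟩
  ∑< m f                            ∎
  where open ≤-Reasoning

∑≡0⇒≡0 : ∀ n (f : ℕ → ℕ) → ∑< n f ≡ 0 → ∀ i → i < n → f i ≡ 0
∑≡0⇒≡0 (suc n) f ∑≡0 i i<1+n with m<1+n⇒m<n∨m≡n i<1+n
... | inj₁ i<n  = ∑≡0⇒≡0 n f (m+n≡0⇒m≡0 (∑< n f) ∑≡0) i i<n
... | inj₂ refl = m+n≡0⇒n≡0 (∑< n f) ∑≡0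

∑-≡0 : ∀ n {f : ℕ → ℕ} → (∀ i → i < n → f i ≡ 0) → ∑< n f ≡ 0
∑-≡0 n f≡0 = trans (∑-cong n f≡0) (trans (∑-const n 0) (*-zeroʳ n))

≤-∑ : ∀ n (f : ℕ → ℕ) {i} → i < n → f i ≤ ∑< n f
≤-∑ (suc n) f i<1+n with m<1+n⇒m<n∨m≡n i<1+n
... | inj₁ i<n  = ≤-trans (≤-∑ n f i<n) (m≤m+n _ _)
... | inj₂ refl = m≤n+m _ _

∑-δ : ∀ n {y} (g : ℕ → ℕ) → y < n → ∑[ x < n ] (𝟙 (y ≟ x) * g x) ≡ g y
∑-δ (suc n) {y} g y<1+n with m<1+n⇒m<n∨m≡n y<1+n
... | inj₁ y<n  = trans (cong₂ _+_ (∑-δ n g y<n) (cong (_* g n) (𝟙-no (y ≟ n) (<⇒≢ y<n))))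
                        (+-identityʳ (g y))
... | inj₂ refl = cong₂ _+_ (∑-≡0 n (λ x x<n → cong (_* g x) (𝟙-no (n ≟ x) (>⇒≢ x<n))))
                            (trans (cong (_* g n) (𝟙-yes (n ≟ n) refl)) (*-identityˡ (g n)))

InjectiveOn : ℕ → (ℕ → ℕ) → Set
InjectiveOn n f = ∀ {i j} → i < n → j < n → f i ≡ f j → i ≡ j

∑-fiber≤1 : ∀ n {f} x → InjectiveOn n f → ∑[ c < n ] 𝟙 (f c ≟ x) ≤ 1
∑-fiber≤1 zero    x _   = z≤n
∑-fiber≤1 (suc n) {f} x inj with f n ≟ x
... | yes refl = ≤-reflexive (cong (_+ 1) (∑-≡0 n (λ c c<n → 𝟙-no (f c ≟ f n)
                   (λ fc≡fn → <⇒≢ c<n (inj (m<n⇒m<1+n c<n) ≤-refl fc≡fn)))))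
... | no  _    = ≤-trans (≤-reflexive (+-identityʳ _))
                   (∑-fiber≤1 n x (λ i<n j<n → inj (m<n⇒m<1+n i<n) (m<n⇒m<1+n j<n)))

∑-∘-injective : ∀ n n′ {f} (g : ℕ → ℕ) → (∀ c → c < n → f c < n′) → InjectiveOn n f →
                ∑[ c < n ] g (f c) ≤ ∑< n′ g
∑-∘-injective n n′ {f} g f<n′ inj = begin
  ∑[ c < n ] g (f c)                              ≡⟨ ∑-cong n (λ c c<n → ∑-δ n′ g (f<n′ c c<n)) ⟨
  ∑[ c < n ] ∑[ x < n′ ] (𝟙 (f c ≟ x) * g x)      ≡⟨ ∑-comm n n′ _ ⟩
  ∑[ x < n′ ] ∑[ c < n ] (𝟙 (f c ≟ x) * g x)      ≡⟨ ∑-cong n′ (λ x _ → *-distribʳ-∑ n (g x) _) ⟨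
  ∑[ x < n′ ] (∑[ c < n ] 𝟙 (f c ≟ x) * g x)      ≤⟨ ∑-mono-≤ n′ (λ x _ → *-monoˡ-≤ (g x) (∑-fiber≤1 n x inj)) ⟩
  ∑[ x < n′ ] (1 * g x)                           ≡⟨ ∑-cong n′ (λ x _ → *-identityˡ (g x)) ⟩
  ∑< n′ g                                         ∎
  where open ≤-Reasoning

∑-𝟙≤ : ∀ n h → ∑[ x < n ] 𝟙 (x ≤? h) ≡ n ⊓ suc h
∑-𝟙≤ zero    h = refl
∑-𝟙≤ (suc n) h with n ≤? h
... | yes n≤h = trans (+-comm (∑[ x < n ] 𝟙 (x ≤? h)) 1)
                      (cong suc (trans (∑-𝟙≤ n h) (trans (m≤n⇒m⊓n≡m (m≤n⇒m≤1+n n≤h)) (sym (m≤n⇒m⊓n≡m n≤h)))))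
... | no  n≰h = trans (+-identityʳ _)
                      (trans (∑-𝟙≤ n h) (trans (m≥n⇒m⊓n≡n (≰⇒> n≰h)) (sym (m≥n⇒m⊓n≡n (m≤n⇒m≤1+n (≰⇒> n≰h))))))

-- Density zero

-- Equivalent to (1 / a) · ∑_{s<a} f s → 0 as a → ∞.
DensityZero : (ℕ → ℕ) → Set
DensityZero f = ∀ c → ∃[ B ] (∀ a → c * ∑< a f ≤ a + B)

densityZero-≡0 : ∀ {f} → (∀ s → f s ≡ 0) → DensityZero f
densityZero-≡0 f≡0 c = 0 , λ a →
  ≤-trans (≤-reflexive (trans (cong (c *_) (∑-≡0 a (λ s _ → f≡0 s))) (*-zeroʳ c))) z≤n

densityZero-mono : ∀ {f g} → (∀ s → f s ≤ g s) → DensityZero g → DensityZero f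
densityZero-mono f≤g g₀ c with g₀ c
... | B , bound = B , λ a → ≤-trans (*-monoʳ-≤ c (∑-mono-≤ a (λ s _ → f≤g s))) (bound a)

densityZero-+ : ∀ {f g} → DensityZero f → DensityZero g → DensityZero (λ s → f s + g s)
densityZero-+ {f} {g} f₀ g₀ c with f₀ (2 * c) | g₀ (2 * c)
... | B₁ , bound₁ | B₂ , bound₂ = B₁ + B₂ , λ a → *-cancelˡ-≤ 2 (begin
  2 * (c * ∑[ s < a ] (f s + g s))            ≡⟨ cong (λ x → 2 * (c * x)) (∑-distrib-+ a f g) ⟩
  2 * (c * (∑< a f + ∑< a g))                 ≡⟨ distribute c (∑< a f) (∑< a g) ⟩
  2 * c * ∑< a f + 2 * c * ∑< a g             ≤⟨ +-mono-≤ (bound₁ a) (bound₂ a) ⟩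
  a + B₁ + (a + B₂)                           ≤⟨ m≤m+n _ (B₁ + B₂) ⟩
  a + B₁ + (a + B₂) + (B₁ + B₂)               ≡⟨ collect a B₁ B₂ ⟩
  2 * (a + (B₁ + B₂))                         ∎)
  where
  open ≤-Reasoning
  distribute : ∀ c x y → 2 * (c * (x + y)) ≡ 2 * c * x + 2 * c * y
  distribute = solve-∀
  collect : ∀ n x y → n + x + (n + y) + (x + y) ≡ 2 * (n + (x + y))
  collect = solve-∀

densityZero-∑ : ∀ n (g : ℕ → ℕ → ℕ) → (∀ i → i < n → DensityZero (g i)) →
                DensityZero (λ s → ∑[ i < n ] g i s)
densityZero-∑ zero    g g₀ = densityZero-≡0 (λ _ → refl)
densityZero-∑ (suc n) g g₀ =
  densityZero-+ (densityZero-∑ n g (λ i i<n → g₀ i (m<n⇒m<1+n i<n))) (g₀ n ≤-refl)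

densityZero⇒eventually-small : ∀ {f} → DensityZero f →
                               ∀ k → ∃[ A ] (∀ a → a ≥ A → suc k * ∑< a f < a)
densityZero⇒eventually-small {f} f₀ k with f₀ (2 * suc k)
... | B , bound = suc B , λ a a>B → *-cancelˡ-< 2 _ _ (begin-strict
  2 * (suc k * ∑< a f)  ≡⟨ *-assoc 2 (suc k) (∑< a f) ⟨
  2 * suc k * ∑< a f    ≤⟨ bound a ⟩
  a + B                 <⟨ +-monoʳ-< a a>B ⟩
  a + a                 ≡⟨ cong (a +_) (+-identityʳ a) ⟨
  2 * a                 ∎)
  where open ≤-Reasoning

densityZero-¬→ : ∀ {A : Set} {B : ℕ → Set} (A? : Dec A) (B? : ∀ s → Dec (B s)) →
                 (A → DensityZero (λ s → 𝟙 (¬? (B? s)))) → DensityZero (λ s → 𝟙 (¬? (A? →-dec B? s)))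
densityZero-¬→ A?@(yes a) B? dz = densityZero-mono
  (λ s → 𝟙-mono (¬? (A? →-dec B? s)) (¬? (B? s)) (λ ¬a→b b → ¬a→b (λ _ → b))) (dz a)
densityZero-¬→ A?@(no ¬a) B? _  = densityZero-≡0
  (λ s → 𝟙-no (¬? (A? →-dec B? s)) (λ ¬a→b → ¬a→b (λ a → ⊥-elim (¬a a))))

-- Carries

central-binomial : ∀ n → ((2 * n) C n) * (n ! * n !) ≡ (2 * n) !
central-binomial n = begin
  ((2 * n) C n) * (n ! * n !)             ≡⟨ cong (λ k → ((2 * n) C n) * (n ! * k !)) [2n∸n]≡n ⟨
  ((2 * n) C n) * (n ! * (2 * n ∸ n) !)   ≡⟨ cong (_* (n ! * (2 * n ∸ n) !)) (nCk≡n!/k![n-k]! n≤2n) ⟩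
  (2 * n) ! / (n ! * (2 * n ∸ n) !) * (n ! * (2 * n ∸ n) !) ≡⟨ m/n*n≡m (k![n∸k]!∣n! n≤2n) ⟩
  (2 * n) !                             ∎
  where
  open ≡-Reasoning
  instance
    _ : NonZero (n ! * (2 * n ∸ n) !)
    _ = m*n≢0 (n !) ((2 * n ∸ n) !) {{n !≢0}} {{(2 * n ∸ n) !≢0}}
  n≤2n : n ≤ 2 * n
  n≤2n = m≤m+n n (n + 0)
  [2n∸n]≡n : 2 * n ∸ n ≡ n
  [2n∸n]≡n = trans (m+n∸m≡n n (n + 0)) (+-identityʳ n)

-- For q = p ^ (i + 1), carry q n = 1 exactly when adding n to itself in base p carries out of
-- position i.
carry : (q n : ℕ) .{{_ : NonZero q}} → ℕ
carry q n = 𝟙 (q ≤? 2 * (n % q))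

carry*q≤2[n%q] : ∀ n q .{{_ : NonZero q}} → carry q n * q ≤ 2 * (n % q)
carry*q≤2[n%q] n q with q ≤? 2 * (n % q)
... | yes q≤2r = ≤-trans (≤-reflexive (*-identityˡ q)) q≤2r
... | no  _    = z≤n

2[n/q]+carry≤2n/q : ∀ n q .{{_ : NonZero q}} → 2 * (n / q) + carry q n ≤ (2 * n) / q
2[n/q]+carry≤2n/q n q = m*n≤o⇒m≤o/n q (begin
  (2 * (n / q) + carry q n) * q      ≡⟨ *-distribʳ-+ q (2 * (n / q)) (carry q n) ⟩
  2 * (n / q) * q + carry q n * q    ≤⟨ +-monoʳ-≤ _ (carry*q≤2[n%q] n q) ⟩
  2 * (n / q) * q + 2 * (n % q)      ≡⟨ double (n / q) q (n % q) ⟩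
  2 * (n % q + n / q * q)            ≡⟨ cong (2 *_) (m≡m%n+[m/n]*n n q) ⟨
  2 * n                              ∎)
  where
  open ≤-Reasoning
  double : ∀ d q r → 2 * d * q + 2 * r ≡ 2 * (r + d * q)
  double = solve-∀

-- Digits, prime factors, and digits of powers

module Digits (b : ℕ) .{{_ : NonZero b}} where

  b^≢0 : ∀ i → NonZero (b ^ i)
  b^≢0 i = m^n≢0 b i

  infixl 7 _/b^_

  _/b^_ : ℕ → ℕ → ℕ
  x /b^ i = (x / b ^ i) {{b^≢0 i}}

  /b^-suc : ∀ x i → x /b^ suc i ≡ x /b^ i / b
  /b^-suc x i = sym (trans (m/n/o≡m/[n*o] x (b ^ i) b {{b^≢0 i}} {{_}} {{b^i*b≢0}})
                           (/-congʳ {{b^i*b≢0}} {{b^≢0 (suc i)}} (*-comm (b ^ i) b)))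
    where
    b^i*b≢0 : NonZero (b ^ i * b)
    b^i*b≢0 = m*n≢0 (b ^ i) b {{b^≢0 i}}

  digit : ℕ → ℕ → ℕ
  digit i x = x /b^ i % b

  +-*/b^ : ∀ i y w → (y + b ^ i * w) /b^ i ≡ y /b^ i + w
  +-*/b^ i y w = trans (+-distrib-/-∣ʳ y (divides w (*-comm (b ^ i) w)))
                       (cong (y /b^ i +_) (trans (/-congˡ {o = b ^ i} (*-comm (b ^ i) w)) (m*n/n≡m w (b ^ i))))
    where instance _ = b^≢0 i

  digit-+-higher : ∀ {i K} y w → i < K → digit i (y + b ^ K * w) ≡ digit i y
  digit-+-higher {i} y w (s≤s i≤K′) with m≤n⇒∃[o]m+o≡n i≤K′
  ... | r , refl = begin
    (y + b ^ (suc i + r) * w) /b^ i % b     ≡⟨ cong (λ x → (y + x) /b^ i % b) split ⟨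
    (y + b ^ i * (b ^ r * w * b)) /b^ i % b ≡⟨ cong (_% b) (+-*/b^ i y _) ⟩
    (y /b^ i + b ^ r * w * b) % b           ≡⟨ [m+kn]%n≡m%n (y /b^ i) (b ^ r * w) b ⟩
    y /b^ i % b                             ∎
    where
    open ≡-Reasoning
    split : b ^ i * (b ^ r * w * b) ≡ b ^ (suc i + r) * w
    split = trans (rearrange b (b ^ i) (b ^ r) w) (cong (λ t → b * t * w) (sym (^-distribˡ-+-* b i r)))
      where
      rearrange : ∀ b x z w → x * (z * w * b) ≡ b * (x * z) * w
      rearrange = solve-∀

  digit-+-at : ∀ K y A B → digit K (y + b ^ K * A + b ^ suc K * B) ≡ (digit K y + A) % b
  digit-+-at K y A B = begin
    (y + b ^ K * A + b ^ suc K * B) /b^ K % b ≡⟨ cong (λ x → x /b^ K % b) (regroup y (b ^ K) A B b) ⟩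
    (y + b ^ K * (A + B * b)) /b^ K % b     ≡⟨ cong (_% b) (+-*/b^ K y (A + B * b)) ⟩
    (y /b^ K + (A + B * b)) % b             ≡⟨ cong (_% b) (+-assoc (y /b^ K) A (B * b)) ⟨
    (y /b^ K + A + B * b) % b               ≡⟨ [m+kn]%n≡m%n (y /b^ K + A) B b ⟩
    (y /b^ K + A) % b                       ≡⟨ %-distribˡ-+ (y /b^ K) A b ⟩
    (y /b^ K % b + A % b) % b               ≡⟨ cong (λ x → (x + A % b) % b) (m%n%n≡m%n (y /b^ K) b) ⟨
    (y /b^ K % b % b + A % b) % b           ≡⟨ %-distribˡ-+ (digit K y) A b ⟨
    (digit K y + A) % b                     ∎
    where
    open ≡-Reasoning
    regroup : ∀ y P A B b → y + P * A + b * P * B ≡ y + P * (A + B * b)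
    regroup = solve-∀

  large-digit⇒carry : ∀ i n → b ≤ 2 * digit i n → carry (b ^ suc i) n {{b^≢0 (suc i)}} ≡ 1
  large-digit⇒carry i n b≤2d = 𝟙-yes (_ ≤? _) (begin
    b * b ^ i                       ≤⟨ *-monoˡ-≤ (b ^ i) b≤2d ⟩
    2 * digit i n * b ^ i           ≡⟨ cong (λ d → 2 * d * b ^ i) (m%[n*o]/o≡m/o%n n b (b ^ i)) ⟨
    2 * (r / b ^ i) * b ^ i         ≡⟨ *-assoc 2 (r / b ^ i) (b ^ i) ⟩
    2 * (r / b ^ i * b ^ i)         ≤⟨ *-monoʳ-≤ 2 (m/n*n≤m r (b ^ i)) ⟩
    2 * r                           ∎)
    where
    open ≤-Reasoning
    instance
      _ = b^≢0 i
      _ = b^≢0 (suc i)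
    r = n % (b * b ^ i)

module PrimeFactors {p} (p-prime : Prime p) where

  instance
    p≢0 : NonZero p
    p≢0 = prime⇒nonZero p-prime

  open Digits p renaming (_/b^_ to _/p^_; /b^-suc to /p^-suc)

  1<p : 1 < p
  1<p = nonTrivial⇒n>1 p {{prime⇒nonTrivial p-prime}}

  ∤1 : ¬ p ∣ 1
  ∤1 p∣1 = <⇒≱ 1<p (∣⇒≤ p∣1)

  ∤-* : ∀ {m n} → ¬ p ∣ m → ¬ p ∣ n → ¬ p ∣ m * n
  ∤-* {m} {n} p∤m p∤n p∣mn = [ p∤m , p∤n ] (euclidsLemma m n p-prime p∣mn)

  ^∣-cancelʳ-∤ : ∀ {v} → ¬ p ∣ v → ∀ x c → p ^ x ∣ c * v → p ^ x ∣ c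
  ^∣-cancelʳ-∤ p∤v zero    c _ = 1∣ c
  ^∣-cancelʳ-∤ {v} p∤v (suc x) c p^[1+x]∣cv
    with euclidsLemma c v p-prime (∣-trans (m∣m*n (p ^ x)) p^[1+x]∣cv)
  ... | inj₂ p∣v = ⊥-elim (p∤v p∣v)
  ... | inj₁ (divides q refl) = subst (p * p ^ x ∣_) (*-comm p q) (*-monoʳ-∣ p p^x∣q)
    where
    p^x∣q : p ^ x ∣ q
    p^x∣q = ^∣-cancelʳ-∤ p∤v x q (*-cancelˡ-∣ p (subst (p * p ^ x ∣_) (rearrange q p v) p^[1+x]∣cv))
      where
      rearrange : ∀ q p v → q * p * v ≡ p * (q * v)
      rearrange = solve-∀

  -- Equality up to a factor prime to p; it stands in for equality of p-adic valuations.
  infix 4 _∼_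

  record _∼_ (x y : ℕ) : Set where
    constructor mk∼
    field
      cofactor : ℕ
      ∤cofactor : ¬ p ∣ cofactor
      ≡*cofactor : x ≡ y * cofactor

  ∼-reflexive : ∀ {x y} → x ≡ y → x ∼ y
  ∼-reflexive {x} refl = mk∼ 1 ∤1 (sym (*-identityʳ x))

  ∼-trans : ∀ {x y z} → x ∼ y → y ∼ z → x ∼ z
  ∼-trans {z = z} (mk∼ u p∤u refl) (mk∼ v p∤v refl) = mk∼ (v * u) (∤-* p∤v p∤u) (*-assoc z v u)

  ∼-isPreorder : IsPreorder _≡_ _∼_
  ∼-isPreorder = record { isEquivalence = isEquivalence ; reflexive = ∼-reflexive ; trans = ∼-trans }

  ∼-preorder : Preorder _ _ _
  ∼-preorder = record { isPreorder = ∼-isPreorder }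

  module ∼-Reasoning = PreorderReasoning ∼-preorder

  ∼-* : ∀ {x y x′ y′} → x ∼ y → x′ ∼ y′ → x * x′ ∼ y * y′
  ∼-* {y = y} {y′ = y′} (mk∼ u p∤u refl) (mk∼ v p∤v refl) =
    mk∼ (u * v) (∤-* p∤u p∤v) (*-interchange y u y′ v)
    where
    *-interchange : ∀ a b c d → a * b * (c * d) ≡ a * c * (b * d)
    *-interchange = solve-∀

  ∼-*ˡ : ∀ z {x y} → x ∼ y → z * x ∼ z * y
  ∼-*ˡ z = ∼-* (∼-reflexive {z} refl)

  *∼ : ∀ {u} x → ¬ p ∣ u → u * x ∼ x
  *∼ {u} x p∤u = mk∼ u p∤u (*-comm u x)

  ^∣-quotient : ∀ {c x x′ y y′} g .{{_ : NonZero x′}} → c * x ≡ y → x ∼ x′ → y ∼ y′ →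
                p ^ g * x′ ∣ y′ → p ^ g ∣ c
  ^∣-quotient {c} {x′ = x′} g cx≡y (mk∼ u p∤u refl) (mk∼ v _ y≡y′v) (divides q refl) =
    ^∣-cancelʳ-∤ p∤u g c (divides (q * v) (*-cancelʳ-≡ _ _ x′ (begin
      c * u * x′            ≡⟨ swap c u x′ ⟩
      c * (x′ * u)          ≡⟨ trans cx≡y y≡y′v ⟩
      q * (p ^ g * x′) * v  ≡⟨ collect q (p ^ g) x′ v ⟩
      q * v * p ^ g * x′    ∎)))
    where
    open ≡-Reasoning
    swap : ∀ c u x → c * u * x ≡ c * (x * u)
    swap = solve-∀
    collect : ∀ q P x v → q * (P * x) * v ≡ q * v * P * x
    collect = solve-∀

  factorial-+-residue : ∀ q r → r < p → (q * p + r) ! ∼ (q * p) !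
  factorial-+-residue q zero    _   = ∼-reflexive (cong _! (+-identityʳ (q * p)))
  factorial-+-residue q (suc r) r<p = begin
    (q * p + suc r) !               ≡⟨ cong _! (+-suc (q * p) r) ⟩
    suc (q * p + r) * (q * p + r) ! ∼⟨ *∼ _ p∤ ⟩
    (q * p + r) !                   ∼⟨ factorial-+-residue q r (<-trans (n<1+n r) r<p) ⟩
    (q * p) !                       ∎
    where
    open ∼-Reasoning
    p∤ : ¬ p ∣ suc (q * p + r)
    p∤ = subst (λ n → ¬ p ∣ n) (+-suc (q * p) r) (∤-*+ q (s≤s z≤n) r<p)

  factorial-*p : ∀ q → (q * p) ! ∼ p ^ q * q !
  factorial-*p zero    = ∼-reflexive refl
  factorial-*p (suc q) = begin
    (suc q * p) !                        ≡⟨ cong _! [1+q]p≡ ⟩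
    suc (q * p + pred p) !               ≡⟨ cong (_* (q * p + pred p) !) [1+q]p≡ ⟨
    suc q * p * (q * p + pred p) !       ∼⟨ ∼-*ˡ (suc q * p) (factorial-+-residue q (pred p) pred[p]<p) ⟩
    suc q * p * (q * p) !                ∼⟨ ∼-*ˡ (suc q * p) (factorial-*p q) ⟩
    suc q * p * (p ^ q * q !)            ≡⟨ rearrange q p (p ^ q) (q !) ⟩
    p * p ^ q * (suc q * q !)            ∎
    where
    open ∼-Reasoning
    pred[p]<p : pred p < p
    pred[p]<p = ≤-reflexive (suc-pred p)
    [1+q]p≡ : suc q * p ≡ suc (q * p + pred p)
    [1+q]p≡ = trans (cong (_+ q * p) (sym (suc-pred p))) (cong suc (+-comm (pred p) (q * p)))
    rearrange : ∀ q p P F → suc q * p * (P * F) ≡ p * P * (suc q * F)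
    rearrange = solve-∀

  factorial-∼ : ∀ k → k ! ∼ p ^ (k / p) * (k / p) !
  factorial-∼ k = begin
    k !                       ≡⟨ cong _! (trans (m≡m%n+[m/n]*n k p) (+-comm (k % p) _)) ⟩
    (k / p * p + k % p) !     ∼⟨ factorial-+-residue (k / p) (k % p) (m%n<n k p) ⟩
    (k / p * p) !             ∼⟨ factorial-*p (k / p) ⟩
    p ^ (k / p) * (k / p) !   ∎
    where open ∼-Reasoning

  legendre : ∀ L k → k ! ∼ p ^ (∑[ i < L ] (k /p^ suc i)) * (k /p^ L) !
  legendre zero    k = ∼-reflexive (trans (cong _! (sym (n/1≡n k))) (sym (+-identityʳ _)))
  legendre (suc L) k = begin
    k !                                            ∼⟨ legendre L k ⟩
    p ^ S * (k /p^ L) !                            ∼⟨ ∼-*ˡ (p ^ S) (factorial-∼ (k /p^ L)) ⟩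
    p ^ S * (p ^ (k /p^ L / p) * (k /p^ L / p) !)  ≡⟨ cong (λ n → p ^ S * (p ^ n * n !)) (/p^-suc k L) ⟨
    p ^ S * (p ^ (k /p^ suc L) * (k /p^ suc L) !)  ≡⟨ *-assoc (p ^ S) _ _ ⟨
    p ^ S * p ^ (k /p^ suc L) * (k /p^ suc L) !    ≡⟨ cong (_* (k /p^ suc L) !) (^-distribˡ-+-* p S _) ⟨
    p ^ (S + k /p^ suc L) * (k /p^ suc L) !        ∎
    where
    open ∼-Reasoning
    S = ∑[ i < L ] (k /p^ suc i)

  carry-at : ℕ → ℕ → ℕ
  carry-at n i = carry (p ^ suc i) n {{b^≢0 (suc i)}}

  carries : ℕ → ℕ → ℕ
  carries L n = ∑< L (carry-at n)

  p^carries∣central-binomial : ∀ L n → p ^ carries L n ∣ (2 * n) C n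
  p^carries∣central-binomial L n =
    ^∣-quotient G {{x′≢0}} (central-binomial n) (∼-* (legendre L n) (legendre L n))
                (legendre L (2 * n)) (subst (_∣ p ^ A * M !) regroup p^G*p^2B*m!m!∣)
    where
    G = carries L n
    A = ∑[ i < L ] ((2 * n) /p^ suc i)
    B = ∑[ i < L ] (n /p^ suc i)
    m = n /p^ L
    M = (2 * n) /p^ L
    x′≢0 : NonZero (p ^ B * m ! * (p ^ B * m !))
    x′≢0 = m*n≢0 _ _ {{p^B*m!≢0}} {{p^B*m!≢0}}
      where
      p^B*m!≢0 : NonZero (p ^ B * m !)
      p^B*m!≢0 = m*n≢0 (p ^ B) (m !) {{b^≢0 B}} {{m !≢0}}
    G+2B≤A : G + (B + B) ≤ A
    G+2B≤A = begin
      G + (B + B)                                           ≡⟨ +-comm G (B + B) ⟩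
      B + B + G                                             ≡⟨ cong (_+ G) (∑-distrib-+ L _ _) ⟨
      ∑[ i < L ] (n /p^ suc i + n /p^ suc i) + G            ≡⟨ ∑-distrib-+ L _ _ ⟨
      ∑[ i < L ] (n /p^ suc i + n /p^ suc i + carry-at n i) ≡⟨ ∑-cong L (λ i _ → cong (λ x → n /p^ suc i + x + carry-at n i) (+-identityʳ _)) ⟨
      ∑[ i < L ] (2 * (n /p^ suc i) + carry-at n i)         ≤⟨ ∑-mono-≤ L (λ i _ → 2[n/q]+carry≤2n/q n (p ^ suc i) {{b^≢0 (suc i)}}) ⟩
      A                                                     ∎
      where open ≤-Reasoning
    m!m!∣M! : m ! * m ! ∣ M !
    m!m!∣M! = ∣-trans (divides ((2 * m) C m) (sym (central-binomial m)))
                      (m≤n⇒m!∣n! (≤-trans (m≤m+n (2 * m) _) (2[n/q]+carry≤2n/q n (p ^ L) {{b^≢0 L}})))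
    p^G*p^2B*m!m!∣ : p ^ (G + (B + B)) * (m ! * m !) ∣ p ^ A * M !
    p^G*p^2B*m!m!∣ = *-pres-∣ (^-monoʳ-∣ p G+2B≤A) m!m!∣M!
    regroup : p ^ (G + (B + B)) * (m ! * m !) ≡ p ^ G * (p ^ B * m ! * (p ^ B * m !))
    regroup = begin
      p ^ (G + (B + B)) * (m ! * m !)        ≡⟨ cong (_* (m ! * m !)) (^-distribˡ-+-* p G (B + B)) ⟩
      p ^ G * p ^ (B + B) * (m ! * m !)      ≡⟨ cong (λ x → p ^ G * x * (m ! * m !)) (^-distribˡ-+-* p B B) ⟩
      p ^ G * (p ^ B * p ^ B) * (m ! * m !)  ≡⟨ interchange (p ^ G) (p ^ B) (m !) ⟩
      p ^ G * (p ^ B * m ! * (p ^ B * m !))  ∎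
      where
      open ≡-Reasoning
      interchange : ∀ x y z → x * (y * y) * (z * z) ≡ x * (y * z * (y * z))
      interchange = solve-∀

  +-*%-injective-≤ : ∀ d {v} → ¬ p ∣ v → ∀ {i j} → i ≤ j → j < p →
                     (d + i * v) % p ≡ (d + j * v) % p → i ≡ j
  +-*%-injective-≤ d {v} p∤v {i} i≤j j<p eq with m≤n⇒∃[o]m+o≡n i≤j
  ... | zero  , refl = sym (+-identityʳ i)
  ... | suc k , refl = ⊥-elim (<⇒≱ j<p (≤-trans (∣⇒≤ p∣1+k) (m≤n+m (suc k) i)))
    where
    regroup : ∀ d i k v → d + (i + k) * v ≡ d + i * v + k * v
    regroup = solve-∀
    p∣[1+k]v : p ∣ suc k * v
    p∣[1+k]v = %≡%-+⇒∣ (d + i * v) (suc k * v) (trans eq (cong (_% p) (regroup d i (suc k) v)))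
    p∣1+k : p ∣ suc k
    p∣1+k = [ id , (λ p∣v → ⊥-elim (p∤v p∣v)) ] (euclidsLemma (suc k) v p-prime p∣[1+k]v)

  +-*%-injective : ∀ d {v} → ¬ p ∣ v → InjectiveOn p (λ c → (d + c * v) % p)
  +-*%-injective d p∤v {i} {j} i<p j<p eq with ≤-total i j
  ... | inj₁ i≤j = +-*%-injective-≤ d p∤v i≤j j<p eq
  ... | inj₂ j≤i = sym (+-*%-injective-≤ d p∤v j≤i i<p (sym eq))

  ∑-small-affine-residues : ∀ d {v} h → ¬ p ∣ v → ∑[ c < p ] 𝟙 ((d + c * v) % p ≤? h) ≤ suc h
  ∑-small-affine-residues d {v} h p∤v = begin
    ∑[ c < p ] 𝟙 ((d + c * v) % p ≤? h) ≤⟨ ∑-∘-injective p p (λ x → 𝟙 (x ≤? h))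
                                             (λ c _ → m%n<n (d + c * v) p) (+-*%-injective d p∤v) ⟩
    ∑[ x < p ] 𝟙 (x ≤? h)               ≡⟨ ∑-𝟙≤ p h ⟩
    p ⊓ suc h                           ≤⟨ m⊓n≤n p (suc h) ⟩
    suc h                               ∎
    where open ≤-Reasoning

  ∤-^ : ∀ {a} → ¬ p ∣ a → ∀ n → ¬ p ∣ a ^ n
  ∤-^ p∤a zero    = ∤1
  ∤-^ p∤a (suc n) = ∤-* p∤a (∤-^ p∤a n)

  power≡1+p^[1+t]*u : ∀ {a} → 2 ≤ a → ¬ p ∣ a →
                         ∃[ T ] ∃[ t ] ∃[ u ] (¬ p ∣ u × a ^ suc T ≡ 1 + p ^ suc t * u)
  power≡1+p^[1+t]*u {a} 2≤a p∤a with powers-collide-mod a p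
  ... | x , d , a^x≡a^[x+1+d] with m≤n⇒∃[o]m+o≡n 2≤a^[1+d]
    where
    2≤a^[1+d] : 2 ≤ a ^ suc d
    2≤a^[1+d] = ≤-trans 2≤a (m≤m*n a (a ^ d) {{m^n≢0 a d {{>-nonZero (<-trans z<s 2≤a)}}}})
  ... | y , 2+y≡a^[1+d] with euclidsLemma (a ^ x) (suc y) p-prime (%≡%-+⇒∣ (a ^ x) (a ^ x * suc y) (begin
        a ^ x % p                      ≡⟨ a^x≡a^[x+1+d] ⟩
        a ^ (x + suc d) % p            ≡⟨ cong (_% p) (^-distribˡ-+-* a x (suc d)) ⟩
        a ^ x * a ^ suc d % p          ≡⟨ cong (λ z → a ^ x * z % p) 2+y≡a^[1+d] ⟨
        a ^ x * suc (suc y) % p        ≡⟨ cong (_% p) (*-suc (a ^ x) (suc y)) ⟩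
        (a ^ x + a ^ x * suc y) % p    ∎))
    where open ≡-Reasoning
  ... | inj₁ p∣a^x = ⊥-elim (∤-^ p∤a x p∣a^x)
  ... | inj₂ (divides zero    ())
  ... | inj₂ (divides (suc w) 1+y≡[1+w]p) with factor-out-powers 1<p {suc w} z<s
  ... | t , u , p∤u , 1+w≡p^tu = d , t , u , p∤u , (begin
    a ^ suc d             ≡⟨ 2+y≡a^[1+d] ⟨
    1 + suc y             ≡⟨ cong (1 +_) 1+y≡[1+w]p ⟩
    1 + suc w * p         ≡⟨ cong (λ z → 1 + z * p) 1+w≡p^tu ⟩
    1 + p ^ t * u * p     ≡⟨ cong (1 +_) (regroup (p ^ t) u p) ⟩
    1 + p ^ suc t * u     ∎)
    where
    open ≡-Reasoning
    regroup : ∀ P u p → P * u * p ≡ p * P * u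
    regroup = solve-∀

module SmallDigitWindows
  {p} (h : ℕ) (p≡1+2h : p ≡ suc (2 * h)) (p-prime : Prime p) {a} (p∤a : ¬ p ∣ a)
  (T : ℕ) .{{T≢0 : NonZero T}} {t u} (p∤u : ¬ p ∣ u) (a^T≡ : a ^ T ≡ 1 + p ^ suc t * u)
  where

  open PrimeFactors p-prime
  open Digits p

  K : ℕ → ℕ
  K j = suc (t + j)

  D : ℕ → ℕ
  D j = T * p ^ j

  lifted : ∀ j → ∃[ w ] (¬ p ∣ w × a ^ D j ≡ 1 + p ^ K j * w)
  lifted zero = u , p∤u , trans (cong (a ^_) (*-identityʳ T))
                                (trans a^T≡ (cong (λ k → 1 + p ^ suc k * u) (sym (+-identityʳ t))))
  lifted (suc j) with lifted j
  ... | w , p∤w , a^Dj≡ with lift-exponent h p≡1+2h (t + j) p∤w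
  ... | w′ , p∤w′ , lift≡ = w′ , p∤w′ , (begin
    a ^ (T * (p * p ^ j))      ≡⟨ cong (a ^_) (regroup T p (p ^ j)) ⟩
    a ^ (D j * p)              ≡⟨ ^-*-assoc a (D j) p ⟨
    (a ^ D j) ^ p              ≡⟨ cong (_^ p) a^Dj≡ ⟩
    (1 + p ^ K j * w) ^ p      ≡⟨ lift≡ ⟩
    1 + p ^ suc (K j) * w′     ≡⟨ cong (λ k → 1 + p ^ suc k * w′) (+-suc t j) ⟨
    1 + p ^ K (suc j) * w′     ∎)
    where
    open ≡-Reasoning
    regroup : ∀ T p P → T * (p * P) ≡ T * P * p
    regroup = solve-∀

  w : ℕ → ℕ
  w j = proj₁ (lifted j)

  p∤w : ∀ j → ¬ p ∣ w j
  p∤w j = proj₁ (proj₂ (lifted j))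

  shift-expansion : ∀ j x c → ∃[ B ] (a ^ (x + c * D j) ≡ a ^ x + p ^ K j * (c * (w j * a ^ x)) + p ^ suc (K j) * B)
  shift-expansion j x c with binomial-expansion₂ (p ^ K j * w j) c
  ... | z , eq = a ^ x * (p ^ (t + j) * w j * w j * z) , (begin
    a ^ (x + c * D j)                          ≡⟨ ^-distribˡ-+-* a x (c * D j) ⟩
    a ^ x * a ^ (c * D j)                      ≡⟨ cong (λ k → a ^ x * a ^ k) (*-comm c (D j)) ⟩
    a ^ x * a ^ (D j * c)                      ≡⟨ cong (a ^ x *_) (^-*-assoc a (D j) c) ⟨
    a ^ x * (a ^ D j) ^ c                      ≡⟨ cong (λ y → a ^ x * y ^ c) (proj₂ (proj₂ (lifted j))) ⟩
    a ^ x * (1 + p ^ K j * w j) ^ c            ≡⟨ cong (a ^ x *_) eq ⟩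
    a ^ x * (1 + c * (p ^ K j * w j) + p ^ K j * w j * (p ^ K j * w j) * z)
                                               ≡⟨ regroup (a ^ x) p (p ^ (t + j)) (w j) c z ⟩
    a ^ x + p ^ K j * (c * (w j * a ^ x)) + p ^ suc (K j) * (a ^ x * (p ^ (t + j) * w j * w j * z)) ∎)
    where
    open ≡-Reasoning
    regroup : ∀ A p Q w c z → A * (1 + c * (p * Q * w) + p * Q * w * (p * Q * w) * z) ≡
                              A + p * Q * (c * (w * A)) + p * (p * Q) * (A * (Q * w * w * z))
    regroup = solve-∀

  digit-shift-below : ∀ {i j} x c → i < K j → digit i (a ^ (x + c * D j)) ≡ digit i (a ^ x)
  digit-shift-below {i} {j} x c i<K with shift-expansion j x c
  ... | B , eq = trans (cong (digit i) (trans eq (regroup (a ^ x) (p ^ K j) _ p B)))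
                       (digit-+-higher (a ^ x) _ i<K)
    where
    regroup : ∀ y P A p B → y + P * A + p * P * B ≡ y + P * (A + p * B)
    regroup = solve-∀

  digit-shift-at : ∀ j x c → digit (K j) (a ^ (x + c * D j)) ≡ (digit (K j) (a ^ x) + c * (w j * a ^ x)) % p
  digit-shift-at j x c with shift-expansion j x c
  ... | B , eq = trans (cong (digit (K j)) eq) (digit-+-at (K j) (a ^ x) _ B)

  small : ℕ → ℕ → ℕ
  small j s = 𝟙 (digit (K j) (a ^ s) ≤? h)

  allSmall : ℕ → ℕ → ℕ → ℕ
  allSmall j₀ zero    s = 1
  allSmall j₀ (suc M) s = allSmall j₀ M s * small (j₀ + M) s

  allSmall-shift : ∀ j₀ {M M′} x c → M′ ≤ M → allSmall j₀ M′ (x + c * D (j₀ + M)) ≡ allSmall j₀ M′ x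
  allSmall-shift j₀ {M′ = zero}   x c _      = refl
  allSmall-shift j₀ {M} {suc M′} x c M′<M =
    cong₂ _*_ (allSmall-shift j₀ x c (<⇒≤ M′<M))
              (cong (λ d → 𝟙 (d ≤? h)) (digit-shift-below x c (s<s (+-monoʳ-< t (+-monoʳ-< j₀ M′<M)))))

  allSmall-suc-shift : ∀ j₀ M s c → allSmall j₀ (suc M) (s + c * D (j₀ + M)) ≡
                       allSmall j₀ M s * 𝟙 ((digit (K (j₀ + M)) (a ^ s) + c * (w (j₀ + M) * a ^ s)) % p ≤? h)
  allSmall-suc-shift j₀ M s c = cong₂ _*_ (allSmall-shift j₀ {M} s c ≤-refl)
                                          (cong (λ d → 𝟙 (d ≤? h)) (digit-shift-at (j₀ + M) s c))

  ∑-allSmall-suc-shift : ∀ j₀ M s → ∑[ c < p ] allSmall j₀ (suc M) (s + c * D (j₀ + M)) ≤ allSmall j₀ M s * suc h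
  ∑-allSmall-suc-shift j₀ M s = begin
    ∑[ c < p ] allSmall j₀ (suc M) (s + c * D (j₀ + M))     ≡⟨ ∑-cong p (λ c _ → allSmall-suc-shift j₀ M s c) ⟩
    ∑[ c < p ] (allSmall j₀ M s * 𝟙 ((d + c * v) % p ≤? h))  ≡⟨ *-distribˡ-∑ p (allSmall j₀ M s) _ ⟨
    allSmall j₀ M s * ∑[ c < p ] 𝟙 ((d + c * v) % p ≤? h)    ≤⟨ *-monoʳ-≤ (allSmall j₀ M s)
                                                                  (∑-small-affine-residues d h (∤-* (p∤w (j₀ + M)) (∤-^ p∤a s))) ⟩
    allSmall j₀ M s * suc h                                  ∎
    where
    open ≤-Reasoning
    d = digit (K (j₀ + M)) (a ^ s)
    v = w (j₀ + M) * a ^ s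

  D-+ : ∀ i j → D (i + j) ≡ D i * p ^ j
  D-+ i j = trans (cong (T *_) (^-distribˡ-+-* p i j)) (sym (*-assoc T (p ^ i) (p ^ j)))

  ∑-allSmall-period : ∀ j₀ M s₀ → ∑[ i < D (j₀ + M) ] allSmall j₀ M (s₀ + i) ≤ D j₀ * suc h ^ M
  ∑-allSmall-period j₀ zero    s₀ = ≤-reflexive (trans (∑-const (D (j₀ + 0)) 1) (cong (λ j → D j * 1) (+-identityʳ j₀)))
  ∑-allSmall-period j₀ (suc M) s₀ = begin
    ∑[ i < D (j₀ + suc M) ] F i                               ≡⟨ cong (λ n → ∑< n F) D[j₀+1+M]≡ ⟩
    ∑[ i < p * E ] F i                                        ≡⟨ ∑-* p E F ⟩
    ∑[ c < p ] ∑[ i < E ] F (c * E + i)                       ≡⟨ ∑-comm p E _ ⟩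
    ∑[ i < E ] ∑[ c < p ] F (c * E + i)                       ≡⟨ ∑-cong E (λ i _ → ∑-cong p (λ c _ →
                                                                   cong (allSmall j₀ (suc M)) (regroup s₀ c E i))) ⟩
    ∑[ i < E ] ∑[ c < p ] allSmall j₀ (suc M) (s₀ + i + c * E) ≤⟨ ∑-mono-≤ E (λ i _ → ∑-allSmall-suc-shift j₀ M (s₀ + i)) ⟩
    ∑[ i < E ] (allSmall j₀ M (s₀ + i) * suc h)              ≡⟨ *-distribʳ-∑ E (suc h) _ ⟨
    ∑[ i < E ] allSmall j₀ M (s₀ + i) * suc h                ≤⟨ *-monoˡ-≤ (suc h) (∑-allSmall-period j₀ M s₀) ⟩
    D j₀ * suc h ^ M * suc h                                 ≡⟨ *-assoc (D j₀) _ (suc h) ⟩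
    D j₀ * (suc h ^ M * suc h)                               ≡⟨ cong (D j₀ *_) (*-comm (suc h ^ M) (suc h)) ⟩
    D j₀ * suc h ^ suc M                                     ∎
    where
    open ≤-Reasoning
    E = D (j₀ + M)
    F = λ i → allSmall j₀ (suc M) (s₀ + i)
    D[j₀+1+M]≡ : D (j₀ + suc M) ≡ p * E
    D[j₀+1+M]≡ = trans (cong D (+-suc j₀ M)) (rotate T p (p ^ (j₀ + M)))
      where
      rotate : ∀ T p P → T * (p * P) ≡ p * (T * P)
      rotate = solve-∀
    regroup : ∀ s₀ c E i → s₀ + (c * E + i) ≡ s₀ + i + c * E
    regroup = solve-∀

  ∑-allSmall : ∀ j₀ M n → p ^ M * ∑< n (allSmall j₀ M) ≤ (n + D (j₀ + M)) * suc h ^ M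
  ∑-allSmall j₀ M n = begin
    p ^ M * ∑< n S                                ≤⟨ *-monoʳ-≤ (p ^ M) (∑-monoˡ-≤ S (<⇒≤ (m<[1+m/n]*n n E))) ⟩
    p ^ M * ∑< (N * E) S                          ≡⟨ cong (p ^ M *_) (∑-* N E S) ⟩
    p ^ M * ∑[ b < N ] ∑[ i < E ] S (b * E + i)   ≤⟨ *-monoʳ-≤ (p ^ M) (∑-mono-≤ N (λ b _ → ∑-allSmall-period j₀ M (b * E))) ⟩
    p ^ M * ∑[ b < N ] (D j₀ * suc h ^ M)         ≡⟨ cong (p ^ M *_) (∑-const N _) ⟩
    p ^ M * (N * (D j₀ * suc h ^ M))              ≡⟨ regroup (p ^ M) N (D j₀) (suc h ^ M) ⟩
    N * (D j₀ * p ^ M) * suc h ^ M                ≡⟨ cong (λ x → N * x * suc h ^ M) (D-+ j₀ M) ⟨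
    N * E * suc h ^ M                             ≤⟨ *-monoˡ-≤ (suc h ^ M) ([1+m/n]*n≤m+n n E) ⟩
    (n + E) * suc h ^ M                           ∎
    where
    open ≤-Reasoning
    S = allSmall j₀ M
    E = D (j₀ + M)
    instance
      _ : NonZero E
      _ = m*n≢0 T (p ^ (j₀ + M)) {{T≢0}} {{b^≢0 (j₀ + M)}}
    N = suc (n / E)
    regroup : ∀ P N D H → P * (N * (D * H)) ≡ N * (D * P) * H
    regroup = solve-∀

  allSmall≡0⇒large-digit : ∀ j₀ M s → allSmall j₀ M s ≡ 0 → ∃[ m ] (m < M × h < digit (K (j₀ + m)) (a ^ s))
  allSmall≡0⇒large-digit j₀ (suc M) s ≡0 with m*n≡0⇒m≡0∨n≡0 (allSmall j₀ M s) ≡0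
  ... | inj₂ small≡0 = M , ≤-refl , ≰⇒> (𝟙≡0⇒¬ (_ ≤? h) small≡0)
  ... | inj₁ allSmall≡0 with allSmall≡0⇒large-digit j₀ M s allSmall≡0
  ...   | m , m<M , large = m , m<n⇒m<1+n m<M , large

  large-digit⇒carry-at : ∀ n i → h < digit i n → carry-at n i ≡ 1
  large-digit⇒carry-at n i h<d = large-digit⇒carry i n (≤-trans p≤2[1+h] (*-monoʳ-≤ 2 h<d))
    where
    2[1+h]≡ : ∀ h → suc (suc (2 * h)) ≡ 2 * suc h
    2[1+h]≡ = solve-∀
    p≤2[1+h] : p ≤ 2 * suc h
    p≤2[1+h] = subst (_≤ 2 * suc h) (sym p≡1+2h) (≤-trans (n≤1+n _) (≤-reflexive (2[1+h]≡ h)))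

  windows⇒carries : ∀ e M n → (∀ b → b < e → ∃[ m ] (m < M × h < digit (K (b * M + m)) n)) →
                    e ≤ carries (suc t + e * M) n
  windows⇒carries e M n large = begin
    e                                                   ≡⟨ trans (∑-const e 1) (*-identityʳ e) ⟨
    ∑[ b < e ] 1                                        ≤⟨ ∑-mono-≤ e (λ b b<e → window-carry b (large b b<e)) ⟩
    ∑[ b < e ] ∑[ m < M ] carry-at n (suc t + (b * M + m)) ≡⟨ ∑-* e M _ ⟨
    ∑[ i < e * M ] carry-at n (suc t + i)               ≤⟨ m≤n+m _ _ ⟩
    ∑< (suc t) (carry-at n) + ∑[ i < e * M ] carry-at n (suc t + i) ≡⟨ ∑-+ (suc t) (e * M) _ ⟨
    carries (suc t + e * M) n                           ∎
    where
    open ≤-Reasoning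
    window-carry : ∀ b → ∃[ m ] (m < M × h < digit (K (b * M + m)) n) →
                   1 ≤ ∑[ m < M ] carry-at n (suc t + (b * M + m))
    window-carry b (m , m<M , h<d) =
      ≤-trans (≤-reflexive (sym (large-digit⇒carry-at n (K (b * M + m)) h<d))) (≤-∑ M _ m<M)

  𝟙∤≤∑-allSmall : ∀ e M s → 𝟙 (¬? (p ^ e ∣? (2 * a ^ s) C (a ^ s))) ≤ ∑[ b < e ] allSmall (b * M) M s
  𝟙∤≤∑-allSmall e M s = 𝟙-¬-≤ (p ^ e ∣? _) _ λ ∑≡0 →
    ∣-trans (^-monoʳ-∣ p (windows⇒carries e M (a ^ s) λ b b<e →
              allSmall≡0⇒large-digit (b * M) M s (∑≡0⇒≡0 e _ ∑≡0 b b<e)))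
            (p^carries∣central-binomial (suc t + e * M) (a ^ s))

  1+h<p : suc h < p
  1+h<p = subst (suc h <_) (sym p≡1+2h) (odd-prime-half h (subst Prime p≡1+2h p-prime))
    where
    odd-prime-half : ∀ h → Prime (suc (2 * h)) → suc h < suc (2 * h)
    odd-prime-half zero     1-prime = ⊥-elim (¬prime[1] 1-prime)
    odd-prime-half (suc h′) _       = s≤s (s≤s (≤-trans (s≤s (m≤m+n h′ _)) (≤-reflexive (sym (+-suc h′ (h′ + 0))))))

  densityZero-∤ : ∀ e → DensityZero (λ s → 𝟙 (¬? (p ^ e ∣? (2 * a ^ s) C (a ^ s))))
  densityZero-∤ e c with ^-dominates 1+h<p (c * e)
  ... | M , ceH^M≤p^M = D (e * M) , λ n → *-cancelˡ-≤ (p ^ M) {{b^≢0 M}} (begin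
    p ^ M * (c * ∑< n f)                                     ≡⟨ x[yz]≡y[xz] (p ^ M) c _ ⟩
    c * (p ^ M * ∑< n f)                                     ≤⟨ *-monoʳ-≤ c (*-monoʳ-≤ (p ^ M)
                                                                  (∑-mono-≤ n (λ s _ → 𝟙∤≤∑-allSmall e M s))) ⟩
    c * (p ^ M * ∑[ s < n ] ∑[ b < e ] allSmall (b * M) M s) ≡⟨ cong (λ x → c * (p ^ M * x)) (∑-comm n e _) ⟩
    c * (p ^ M * ∑[ b < e ] ∑< n (allSmall (b * M) M))       ≡⟨ cong (c *_) (*-distribˡ-∑ e (p ^ M) _) ⟩
    c * ∑[ b < e ] (p ^ M * ∑< n (allSmall (b * M) M))       ≤⟨ *-monoʳ-≤ c (∑-mono-≤ e (window-bound n)) ⟩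
    c * ∑[ b < e ] ((n + D (e * M)) * suc h ^ M)             ≡⟨ cong (c *_) (∑-const e _) ⟩
    c * (e * ((n + D (e * M)) * suc h ^ M))                  ≡⟨ regroup c e (n + D (e * M)) (suc h ^ M) ⟩
    c * e * suc h ^ M * (n + D (e * M))                      ≤⟨ *-monoˡ-≤ (n + D (e * M)) ceH^M≤p^M ⟩
    p ^ M * (n + D (e * M))                                  ∎)
    where
    open ≤-Reasoning
    f = λ s → 𝟙 (¬? (p ^ e ∣? (2 * a ^ s) C (a ^ s)))
    x[yz]≡y[xz] : ∀ x y z → x * (y * z) ≡ y * (x * z)
    x[yz]≡y[xz] = solve-∀
    regroup : ∀ c e x y → c * (e * (x * y)) ≡ c * e * y * x
    regroup = solve-∀
    window-bound : ∀ n b → b < e → p ^ M * ∑< n (allSmall (b * M) M) ≤ (n + D (e * M)) * suc h ^ M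
    window-bound n b b<e = ≤-trans (∑-allSmall (b * M) M n)
      (*-monoˡ-≤ (suc h ^ M) (+-monoʳ-≤ n (*-monoʳ-≤ T (^-monoʳ-≤ p (≤-trans (≤-reflexive (+-comm (b * M) M)) (*-monoˡ-≤ M b<e))))))

densityZero-∤-odd-prime-power : ∀ {a} → 2 ≤ a → ∀ {p} h → p ≡ suc (2 * h) → Prime p → ¬ p ∣ a → ∀ e →
                                DensityZero (λ s → 𝟙 (¬? (p ^ e ∣? (2 * a ^ s) C (a ^ s))))
densityZero-∤-odd-prime-power 2≤a h p≡1+2h p-prime p∤a e
  with PrimeFactors.power≡1+p^[1+t]*u p-prime 2≤a p∤a
... | T , t , u , p∤u , a^[1+T]≡ =
  SmallDigitWindows.densityZero-∤ h p≡1+2h p-prime p∤a (suc T) {t = t} p∤u a^[1+T]≡ e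

-- Reduction to odd prime powers

∣-by-prime-powers : ∀ {ps} → All Prime ps → ∀ c →
                    (∀ q j → Prime q → q ^ j ∣ product ps → q ^ j ∣ c) → product ps ∣ c
∣-by-prime-powers []                           c _   = 1∣ c
∣-by-prime-powers {p ∷ ps} (p-prime ∷ ps-prime) c hyp with p∣c
  where
  p∣c : p ∣ c
  p∣c = subst (_∣ c) (*-identityʳ p) (hyp p 1 p-prime (subst (_∣ p * product ps) (sym (*-identityʳ p)) (m∣m*n (product ps))))
... | divides c′ refl = subst (p * product ps ∣_) (*-comm p c′) (*-monoʳ-∣ p (∣-by-prime-powers ps-prime c′ hyp′))
  where
  hyp′ : ∀ q j → Prime q → q ^ j ∣ product ps → q ^ j ∣ c′
  hyp′ q j q-prime q^j∣ with q ≟ p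
  ... | yes refl = *-cancelˡ-∣ q {{prime⇒nonZero q-prime}}
                     (subst (q * q ^ j ∣_) (*-comm c′ q) (hyp q (suc j) q-prime (*-monoʳ-∣ q q^j∣)))
  ... | no  q≢p  = PrimeFactors.^∣-cancelʳ-∤ q-prime q∤p j c′ (hyp q j q-prime (∣-trans q^j∣ (n∣m*n p)))
    where
    q∤p : ¬ q ∣ p
    q∤p q∣p with prime⇒irreducible p-prime q∣p
    ... | inj₁ q≡1 = ¬prime[1] (subst Prime q≡1 q-prime)
    ... | inj₂ q≡p = q≢p q≡p

PrimePowerDivides : ℕ → ℕ → ℕ → ℕ → Set
PrimePowerDivides m c q j = Prime q × q ^ j ∣ m → q ^ j ∣ c

primePowerDivides? : ∀ m c q j → Dec (PrimePowerDivides m c q j)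
primePowerDivides? m c q j = (prime? q ×-dec q ^ j ∣? m) →-dec (q ^ j ∣? c)

𝟙∤≤∑-prime-powers : ∀ m .{{_ : NonZero m}} c →
                    𝟙 (¬? (m ∣? c)) ≤ ∑[ q < suc m ] ∑[ j < suc m ] 𝟙 (¬? (primePowerDivides? m c q j))
𝟙∤≤∑-prime-powers m c = 𝟙-¬-≤ (m ∣? c) _ λ ∑≡0 →
  ∣-trans (∣-reflexive isFactorisation) (∣-by-prime-powers factorsPrime c (λ q j q-prime q^j∣ →
    prime-power-∣ ∑≡0 q j q-prime (∣-trans q^j∣ (∣-reflexive (sym isFactorisation)))))
  where
  open PrimeFactorisation (factorise m)
  prime-power-∣ : ∑[ q < suc m ] ∑[ j < suc m ] 𝟙 (¬? (primePowerDivides? m c q j)) ≡ 0 →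
                  ∀ q j → Prime q → q ^ j ∣ m → q ^ j ∣ c
  prime-power-∣ ∑≡0 q zero    _       _    = 1∣ c
  prime-power-∣ ∑≡0 q (suc j) q-prime q^j∣m =
    𝟙¬≡0⇒ (primePowerDivides? m c q (suc j))
      (∑≡0⇒≡0 (suc m) _ (∑≡0⇒≡0 (suc m) _ ∑≡0 q (s≤s q≤m)) (suc j) (s≤s (<⇒≤ (<-≤-trans (n<m^n 1<q (suc j)) q^j≤m))))
      (q-prime , q^j∣m)
    where
    instance _ = prime⇒nonZero q-prime
    1<q = nonTrivial⇒n>1 q {{prime⇒nonTrivial q-prime}}
    q^j≤m : q ^ suc j ≤ m
    q^j≤m = ∣⇒≤ q^j∣m
    q≤m : q ≤ m
    q≤m = ≤-trans (m≤m*n q (q ^ j) {{m^n≢0 q j}}) q^j≤m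

densityZero-∤-prime-power-of-odd : ∀ {m} → ¬ 2 ∣ m → ∀ {q} j → Prime q → q ^ j ∣ m →
                                   DensityZero (λ s → 𝟙 (¬? (q ^ j ∣? centralBinom2 s)))
densityZero-∤-prime-power-of-odd _ zero _ _ = densityZero-≡0 (λ s → 𝟙-no (¬? (1 ∣? _)) (λ 1∤ → 1∤ (1∣ _)))
densityZero-∤-prime-power-of-odd {m} 2∤m {q} (suc j) q-prime q^j∣m =
  densityZero-∤-odd-prime-power ≤-refl (proj₁ q-odd) (proj₂ q-odd) q-prime q∤2 (suc j)
  where
  q∣m : q ∣ m
  q∣m = ∣-trans (m∣m*n (q ^ j)) q^j∣m
  q-odd : ∃[ h ] q ≡ suc (2 * h)
  q-odd = odd⇒≡1+2* (λ 2∣q → 2∤m (∣-trans 2∣q q∣m))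
  q∤2 : ¬ q ∣ 2
  q∤2 q∣2 with prime⇒irreducible prime[2] q∣2
  ... | inj₁ q≡1 = ¬prime[1] (subst Prime q≡1 q-prime)
  ... | inj₂ q≡2 = 2∤m (subst (_∣ m) q≡2 q∣m)

densityZero-∤-central-binomial : ∀ m → ¬ 2 ∣ m → DensityZero (λ s → 𝟙 (¬? (m ∣? centralBinom2 s)))
densityZero-∤-central-binomial zero    2∤m = ⊥-elim (2∤m (2 ∣0))
densityZero-∤-central-binomial m@(suc _) 2∤m =
  densityZero-mono (λ s → 𝟙∤≤∑-prime-powers m (centralBinom2 s))
    (densityZero-∑ (suc m) _ λ q _ → densityZero-∑ (suc m) _ λ j _ →
      densityZero-¬→ (prime? q ×-dec q ^ j ∣? m) (λ s → q ^ j ∣? centralBinom2 s)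
        λ (q-prime , q^j∣m) → densityZero-∤-prime-power-of-odd 2∤m j q-prime q^j∣m)

badCount≡∑ : ∀ m a → badCount m a ≡ ∑[ s < a ] 𝟙 (¬? (m ∣? centralBinom2 s))
badCount≡∑ m zero    = refl
badCount≡∑ m (suc a) with m ∣? centralBinom2 a
... | yes _ = trans (badCount≡∑ m a) (sym (+-identityʳ _))
... | no  _ = trans (cong suc (badCount≡∑ m a)) (+-comm 1 _)

corollary3p5 : (m : ℕ) → ¬ (2 ∣ m) →
    (k : ℕ) → ∃[ A ] ((a : ℕ) → a ≥ A → suc k * badCount m a < a)
corollary3p5 m 2∤m k with densityZero⇒eventually-small (densityZero-∤-central-binomial m 2∤m) k
... | A , eventually = A , λ a a≥A → subst (λ x → suc k * x < a) (sym (badCount≡∑ m a)) (eventually a a≥A)
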